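{- (1) For every $\lambda C$-value $V$, $(V^{\circ})^{\sim}=V^{\dagger}$. (2) For every $\lambda C$-term $M$ and every VFS-term $N$, $((M;x.N))^{\wr}=(M:\lambda x.N^{\wr})$. (3) For every $\lambda C$-term $M$, $(M^{\bullet})^{\wr}=M^{\star}$. (4) For every $\lambda C$-term $M$, $(M^{\bullet})^{ - }=\overline{M}$. (All equalities are up to $\alpha$-equivalence.)
   Context: Terms are identified up to $\alpha$-equivalence; substitution is capture-avoiding. The calculus $\lambda C$: terms $M,N,P,Q ::= V \mid MN \mid \mathsf{let}\,x:=M\,\mathsf{in}\,N$; values $V,W ::= x\mid \lambda x.M$. The calculus VFS: terms $M,N::=\uparrow V\mid \mathsf{C}_v(V,c)$; values $V,W::=x\mid\lambda x.M$; formal contexts $c::= x.M\mid (W,x.M)$ ($x$ bound in $M$). The calculus CPS: a fixed variable $k$ (the covariable). Commands $M,N::=kV\mid KV\mid VWK$; continuations $K::=\lambda x.M$; values $V,W::=\lambda x.P\mid x$; terms $P::=\lambda k.M$. (These are particular $\lambda$-terms.) VFS-translation from $\lambda C$ to VFS: $x^{\circ}=x$; $(\lambda x.M)^{\circ}=\lambda x.M^{\bullet}$; $M^{\bullet}=(M;x.\uparrow x)$; $(V;x.N)=\mathsf{C}_v(V^{\circ},x.N)$; $(PQ;x.N)=(P;m.(mQ;x.N))$ if $P$ is not a value ($m$ fresh); $(VQ;x.N)=(Q;n.(Vn;x.N))$ if $Q$ is not a value ($n$ fresh); $(VW;x.N)=\mathsf{C}_v(V^{\circ},(W^{\circ},x.N))$;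 $(\mathsf{let}\,y:=M\,\mathsf{in}\,P;x.N)=(M;y.(P;x.N))$. CPS-translation from $\lambda C$ to CPS (for a $\lambda C$-term $M$ and continuation $K$): $x^{\dagger}=x$; $(\lambda x.M)^{\dagger}=\lambda x.\overline{M}$; $\overline{M}=\lambda k.M^{\star}$; $M^{\star}=(M:\lambda x.kx)$; $(V:K)=KV^{\dagger}$; $(PQ:K)=(P:\lambda m.(mQ:K))$ if $P$ is not a value ($m$ fresh); $(VQ:K)=(Q:\lambda n.(Vn:K))$ if $Q$ is not a value ($n$ fresh); $(VW:K)=V^{\dagger}W^{\dagger}K$; $(\mathsf{let}\,y:=M\,\mathsf{in}\,P:K)=(M:\lambda y.(P:K))$. Negative translation from VFS to CPS: $x^{\sim}=x$; $(\lambda x.M)^{\sim}=\lambda x.M^{ - }$; $M^{ - }=\lambda k.M^{\wr}$; $(\uparrow V)^{\wr}=kV^{\sim}$; $(\mathsf{C}_v(V,x.M))^{\wr}=(\lambda x.M^{\wr})V^{\sim}$; $(\mathsf{C}_v(V,(W,x.M)))^{\wr}=V^{\sim}W^{\sim}(\lambda x.M^{\wr})$. -}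

module Defs where

open import Data.Nat using (ℕ; zero; suc; _<ᵇ_)
open import Data.Bool using (if_then_else_)
open import Function using (_∘_)

-- Syntax is in de Bruijn style (terms up to α-equivalence = syntactic equality).
-- A binder binds index 0; free variables of a body are shifted by one.

-- λC
mutual
  data Val : Set where
    var : ℕ → Val
    lam : Tm → Val

  data Tm : Set where
    val   : Val → Tm
    app   : Tm → Tm → Tm
    letin : Tm → Tm → Tm   -- let x := M in N   (x bound in N)

-- VFS
mutual
  data VVal : Set where
    vvar : ℕ → VVal
    vlam : VTm → VVal

  data VTm : Set where
    up : VVal → VTm
    cv : VVal → FCtx → VTm

  data FCtx : Set where
    bind : VTm → FCtx          -- x.M
    pair : VVal → VTm → FCtx   -- (W, x.M)

-- CPS  (the covariable k is a distinguished variable, not a de Bruijn index;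
-- an occurrence of k refers to the nearest enclosing λk)
mutual
  data Cmd : Set where
    kapp : CVal → Cmd                 -- k V
    capp : Cont → CVal → Cmd
    vapp : CVal → CVal → Cont → Cmd

  data Cont : Set where
    clam : Cmd → Cont

  data CVal : Set where
    cvar  : ℕ → CVal
    clamv : CTm → CVal

  data CTm : Set where
    klam : Cmd → CTm                  -- λk.M

wk : ℕ → ℕ → ℕ
wk c i = if i <ᵇ c then i else suc i

lift : (ℕ → ℕ) → ℕ → ℕ
lift ρ zero    = zero
lift ρ (suc i) = suc (ρ i)

mutual
  shV : ℕ → VVal → VVal
  shV c (vvar i) = vvar (wk c i)
  shV c (vlam M) = vlam (shT (suc c) M)

  shT : ℕ → VTm → VTm
  shT c (up V)   = up (shV c V)
  shT c (cv V k) = cv (shV c V) (shF c k)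

  shF : ℕ → FCtx → FCtx
  shF c (bind M)   = bind (shT (suc c) M)
  shF c (pair W M) = pair (shV c W) (shT (suc c) M)

mutual
  shCmd : ℕ → Cmd → Cmd
  shCmd c (kapp V)     = kapp (shCV c V)
  shCmd c (capp K V)   = capp (shK c K) (shCV c V)
  shCmd c (vapp V W K) = vapp (shCV c V) (shCV c W) (shK c K)

  shK : ℕ → Cont → Cont
  shK c (clam M) = clam (shCmd (suc c) M)

  shCV : ℕ → CVal → CVal
  shCV c (cvar i)  = cvar (wk c i)
  shCV c (clamv P) = clamv (shP (suc c) P)

  shP : ℕ → CTm → CTm
  shP c (klam M) = klam (shCmd c M)

-- The renaming ρ maps free variables of the source term
-- to variables of the target context:  trᵨ ρ M N  is  (M⟨ρ⟩ ; x.N)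
-- where N lives in the target context extended by x (index 0).
-- The paper's translation is the instance ρ = identity.

mutual
  valᵒ : (ℕ → ℕ) → Val → VVal
  valᵒ ρ (var i) = vvar (ρ i)
  valᵒ ρ (lam M) = vlam (bulletᵨ (lift ρ) M)

  bulletᵨ : (ℕ → ℕ) → Tm → VTm
  bulletᵨ ρ M = trᵨ ρ M (up (vvar 0))

  trᵨ : (ℕ → ℕ) → Tm → VTm → VTm
  trᵨ ρ (val V)     N = cv (valᵒ ρ V) (bind N)
  trᵨ ρ (app P Q)   N = trApp ρ P Q N
  trᵨ ρ (letin M P) N = trᵨ ρ M (trᵨ (lift ρ) P (shT 1 N))

  trApp : (ℕ → ℕ) → Tm → Tm → VTm → VTm
  trApp ρ (val V)     Q N = trValApp ρ V Q N
  trApp ρ (app a b)   Q N = trᵨ ρ (app a b)   (trVarApp (suc ∘ ρ) Q (shT 1 N))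
  trApp ρ (letin a b) Q N = trᵨ ρ (letin a b) (trVarApp (suc ∘ ρ) Q (shT 1 N))

  trValApp : (ℕ → ℕ) → Val → Tm → VTm → VTm
  trValApp ρ V (val W)     N = cv (valᵒ ρ V) (pair (valᵒ ρ W) N)
  trValApp ρ V (app a b)   N =
    trᵨ ρ (app a b)   (cv (valᵒ (suc ∘ ρ) V) (pair (vvar 0) (shT 1 N)))
  trValApp ρ V (letin a b) N =
    trᵨ ρ (letin a b) (cv (valᵒ (suc ∘ ρ) V) (pair (vvar 0) (shT 1 N)))

  -- (m Q ; x.N) with m the fresh variable of index 0
  trVarApp : (ℕ → ℕ) → Tm → VTm → VTm
  trVarApp ρ (val W)     N = cv (vvar 0) (pair (valᵒ ρ W) N)
  trVarApp ρ (app a b)   N =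
    trᵨ ρ (app a b)   (cv (vvar 1) (pair (vvar 0) (shT 1 N)))
  trVarApp ρ (letin a b) N =
    trᵨ ρ (letin a b) (cv (vvar 1) (pair (vvar 0) (shT 1 N)))

-- CPS-translation.  cpsᵨ ρ M K  is  (M⟨ρ⟩ : K).

mutual
  daggerᵨ : (ℕ → ℕ) → Val → CVal
  daggerᵨ ρ (var i) = cvar (ρ i)
  daggerᵨ ρ (lam M) = clamv (overlineᵨ (lift ρ) M)

  overlineᵨ : (ℕ → ℕ) → Tm → CTm
  overlineᵨ ρ M = klam (starᵨ ρ M)

  starᵨ : (ℕ → ℕ) → Tm → Cmd
  starᵨ ρ M = cpsᵨ ρ M (clam (kapp (cvar 0)))

  cpsᵨ : (ℕ → ℕ) → Tm → Cont → Cmd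
  cpsᵨ ρ (val V)     K = capp K (daggerᵨ ρ V)
  cpsᵨ ρ (app P Q)   K = cpsApp ρ P Q K
  cpsᵨ ρ (letin M P) K = cpsᵨ ρ M (clam (cpsᵨ (lift ρ) P (shK 0 K)))

  cpsApp : (ℕ → ℕ) → Tm → Tm → Cont → Cmd
  cpsApp ρ (val V)     Q K = cpsValApp ρ V Q K
  cpsApp ρ (app a b)   Q K = cpsᵨ ρ (app a b)   (clam (cpsVarApp (suc ∘ ρ) Q (shK 0 K)))
  cpsApp ρ (letin a b) Q K = cpsᵨ ρ (letin a b) (clam (cpsVarApp (suc ∘ ρ) Q (shK 0 K)))

  cpsValApp : (ℕ → ℕ) → Val → Tm → Cont → Cmd
  cpsValApp ρ V (val W)     K = vapp (daggerᵨ ρ V) (daggerᵨ ρ W) K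
  cpsValApp ρ V (app a b)   K =
    cpsᵨ ρ (app a b)   (clam (vapp (daggerᵨ (suc ∘ ρ) V) (cvar 0) (shK 0 K)))
  cpsValApp ρ V (letin a b) K =
    cpsᵨ ρ (letin a b) (clam (vapp (daggerᵨ (suc ∘ ρ) V) (cvar 0) (shK 0 K)))

  cpsVarApp : (ℕ → ℕ) → Tm → Cont → Cmd
  cpsVarApp ρ (val W)     K = vapp (cvar 0) (daggerᵨ ρ W) K
  cpsVarApp ρ (app a b)   K =
    cpsᵨ ρ (app a b)   (clam (vapp (cvar 1) (cvar 0) (shK 0 K)))
  cpsVarApp ρ (letin a b) K =
    cpsᵨ ρ (letin a b) (clam (vapp (cvar 1) (cvar 0) (shK 0 K)))

idℕ : ℕ → ℕ
idℕ i = i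

_° : Val → VVal
V ° = valᵒ idℕ V

_• : Tm → VTm
M • = bulletᵨ idℕ M

tr : Tm → VTm → VTm             -- (M ; x.N)
tr = trᵨ idℕ

_† : Val → CVal
V † = daggerᵨ idℕ V

overline : Tm → CTm
overline = overlineᵨ idℕ

_⋆ : Tm → Cmd
M ⋆ = starᵨ idℕ M

cps : Tm → Cont → Cmd           -- (M : K)
cps = cpsᵨ idℕ

mutual
  _~ : VVal → CVal
  vvar i ~ = cvar i
  vlam M ~ = clamv (M ⁻)

  _⁻ : VTm → CTm
  M ⁻ = klam (M ≀)

  _≀ : VTm → Cmd
  up V ≀              = kapp (V ~)
  cv V (bind M) ≀     = capp (clam (M ≀)) (V ~)
  cv V (pair W M) ≀   = vapp (V ~) (W ~) (clam (M ≀))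

-- The VFS- and CPS-translations recurse on a λC-term in exactly the same way,
-- and the negative translation maps each VFS construct to its CPS counterpart:
-- C_v(V, x.M) to (λx.M) V and C_v(V, (W, x.M)) to V W (λx.M).  Generalised over
-- a renaming of the free variables and over the body N of the formal context,
-- a simultaneous induction therefore matches the two translations clause by
-- clause.  The one step that is not definitional is that the negative
-- translation commutes with weakening, which is needed wherever the body N is
-- pushed under a fresh binder.
module Submission where

open import Defs
open import Data.Nat using (suc)
open import Function using (_∘_)
open import Data.Product using (_×_; _,_)
open import Relation.Binary.PropositionalEquality using (_≡_; refl; cong; cong₂)

mutual
  ~-shV : ∀ c V → shV c V ~ ≡ shCV c (V ~)
  ~-shV c (vvar i) = refl
  ~-shV c (vlam M) = cong (clamv ∘ klam) (≀-shT (suc c) M)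

  ≀-shT : ∀ c M → shT c M ≀ ≡ shCmd c (M ≀)
  ≀-shT c (up V)            = cong kapp (~-shV c V)
  ≀-shT c (cv V (bind M))   = cong₂ (capp ∘ clam) (≀-shT (suc c) M) (~-shV c V)
  ≀-shT c (cv V (pair W M)) =
    vapp-cong (~-shV c V) (~-shV c W) (cong clam (≀-shT (suc c) M))
    where
    vapp-cong : ∀ {V V′ W W′ K K′} → V ≡ V′ → W ≡ W′ → K ≡ K′ → vapp V W K ≡ vapp V′ W′ K′
    vapp-cong refl refl refl = refl

≀-fresh-apply-to-fresh : ∀ N →
  cv (vvar 1) (pair (vvar 0) (shT 1 N)) ≀ ≡ vapp (cvar 1) (cvar 0) (clam (shCmd 1 (N ≀)))
≀-fresh-apply-to-fresh N = cong (vapp (cvar 1) (cvar 0) ∘ clam) (≀-shT 1 N)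

mutual
  ~-valᵒ : ∀ ρ V → valᵒ ρ V ~ ≡ daggerᵨ ρ V
  ~-valᵒ ρ (var i) = refl
  ~-valᵒ ρ (lam M) = cong (clamv ∘ klam) (≀-trᵨ (lift ρ) M (up (vvar 0)))

  ≀-trᵨ : ∀ ρ M N → trᵨ ρ M N ≀ ≡ cpsᵨ ρ M (clam (N ≀))
  ≀-trᵨ ρ (val V)     N = cong (capp (clam (N ≀))) (~-valᵒ ρ V)
  ≀-trᵨ ρ (app P Q)   N = ≀-trApp ρ P Q N
  ≀-trᵨ ρ (letin M P) N =
    ≀-trᵨ-along ρ M _ (≀-trᵨ-along (lift ρ) P (shT 1 N) (≀-shT 1 N))

  ≀-trᵨ-along : ∀ ρ M N {C} → N ≀ ≡ C → trᵨ ρ M N ≀ ≡ cpsᵨ ρ M (clam C)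
  ≀-trᵨ-along ρ M N refl = ≀-trᵨ ρ M N

  ≀-trApp : ∀ ρ P Q N → trApp ρ P Q N ≀ ≡ cpsApp ρ P Q (clam (N ≀))
  ≀-trApp ρ (val V)     Q N = ≀-trValApp ρ V Q N
  ≀-trApp ρ (app a b)   Q N =
    ≀-trᵨ-along ρ (app a b) _ (≀-trVarApp-along (suc ∘ ρ) Q (shT 1 N) (≀-shT 1 N))
  ≀-trApp ρ (letin a b) Q N =
    ≀-trᵨ-along ρ (letin a b) _ (≀-trVarApp-along (suc ∘ ρ) Q (shT 1 N) (≀-shT 1 N))

  ≀-trValApp : ∀ ρ V Q N → trValApp ρ V Q N ≀ ≡ cpsValApp ρ V Q (clam (N ≀))
  ≀-trValApp ρ V (val W)     N =
    cong₂ (λ v w → vapp v w (clam (N ≀))) (~-valᵒ ρ V) (~-valᵒ ρ W)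
  ≀-trValApp ρ V (app a b)   N = ≀-trᵨ-along ρ (app a b)   _ (≀-apply-to-fresh (suc ∘ ρ) V N)
  ≀-trValApp ρ V (letin a b) N = ≀-trᵨ-along ρ (letin a b) _ (≀-apply-to-fresh (suc ∘ ρ) V N)

  ≀-apply-to-fresh : ∀ ρ V N →
    cv (valᵒ ρ V) (pair (vvar 0) (shT 1 N)) ≀ ≡ vapp (daggerᵨ ρ V) (cvar 0) (clam (shCmd 1 (N ≀)))
  ≀-apply-to-fresh ρ V N =
    cong₂ (λ v c → vapp v (cvar 0) (clam c)) (~-valᵒ ρ V) (≀-shT 1 N)

  ≀-trVarApp : ∀ ρ Q N → trVarApp ρ Q N ≀ ≡ cpsVarApp ρ Q (clam (N ≀))
  ≀-trVarApp ρ (val W)     N = cong (λ w → vapp (cvar 0) w (clam (N ≀))) (~-valᵒ ρ W)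
  ≀-trVarApp ρ (app a b)   N = ≀-trᵨ-along ρ (app a b)   _ (≀-fresh-apply-to-fresh N)
  ≀-trVarApp ρ (letin a b) N = ≀-trᵨ-along ρ (letin a b) _ (≀-fresh-apply-to-fresh N)

  ≀-trVarApp-along : ∀ ρ Q N {C} → N ≀ ≡ C → trVarApp ρ Q N ≀ ≡ cpsVarApp ρ Q (clam C)
  ≀-trVarApp-along ρ Q N refl = ≀-trVarApp ρ Q N

theorem2 : (∀ (V : Val) → ((V °) ~) ≡ (V †))
         × (∀ (M : Tm) (N : VTm) → (tr M N ≀) ≡ cps M (clam (N ≀)))
         × (∀ (M : Tm) → ((M •) ≀) ≡ (M ⋆))
         × (∀ (M : Tm) → ((M •) ⁻) ≡ overline M)
theorem2 = ~-valᵒ idℕ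
         , ≀-trᵨ idℕ
         , ≀-bullet
         , cong klam ∘ ≀-bullet
  where
  ≀-bullet : ∀ M → (M •) ≀ ≡ M ⋆
  ≀-bullet M = ≀-trᵨ idℕ M (up (vvar 0))
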